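{- Let $D$ be a digraph of order $n$, let $G$ be its underlying graph with minimum degree $\delta$ and maximum degree $\Delta$, let $\Delta^+$ and $\Delta^-$ be the maximum out-degree and maximum in-degree of $D$, and let $\delta^*$ be the minimum in-degree in $D$ taken over all vertices whose degree in $G$ equals $\delta$. Then $$\rho(D)\ge \frac{n+\Delta-\delta+(\Delta^+-1)(\Delta^- -\delta^*)}{1+\Delta+\Delta^-(\Delta^+-1)},$$ and this bound is sharp (for instance, equality holds for the directed star $S_n$).
   Context: Digraphs are finite, without loops or multiple arcs (opposite arcs allowed). For a vertex $v$, $N^+[v]=\{v\}\cup\{u:(v,u)\text{ is an arc}\}$. A set $B$ of vertices is a packing in $D$ if $|N^+[v]\cap B|\le 1$ for every vertex $v$; $\rho(D)$ is the maximum size of a packing. The directed star $S_n$ is the rooted tree on $n$ vertices consisting of one vertex with arcs to all other $n-1$ vertices. -}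

module Defs where

open import Data.Bool using (Bool; true; false; _∨_; _∧_; if_then_else_)
open import Data.Nat as ℕ using (ℕ; zero; suc; _≤_; _⊔_; _⊓_)
open import Data.Fin using (Fin; zero; suc; _≟_)
open import Data.Maybe using (Maybe; just; nothing; fromMaybe)
open import Data.Product using (Σ; _×_; _,_)
open import Data.Integer as ℤ using (ℤ; +_; 1ℤ)
open import Relation.Nullary.Decidable using (⌊_⌋)
open import Relation.Binary.PropositionalEquality using (_≡_)

-- A digraph on vertex set Fin n: an arc relation (as a Boolean matrix),
-- without loops.  Multiple arcs are impossible; opposite arcs are allowed.
record Digraph (n : ℕ) : Set where
  field
    arc    : Fin n → Fin n → Bool
    noLoop : ∀ v → arc v v ≡ false
open Digraph public

count : ∀ {n} → (Fin n → Bool) → ℕ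
count {zero}  f = 0
count {suc n} f = (if f zero then 1 else 0) ℕ.+ count (λ i → f (suc i))

maxF : ∀ {m} → (Fin (suc m) → ℕ) → ℕ
maxF {zero}  f = f zero
maxF {suc m} f = f zero ⊔ maxF (λ i → f (suc i))

minF : ∀ {m} → (Fin (suc m) → ℕ) → ℕ
minF {zero}  f = f zero
minF {suc m} f = f zero ⊓ minF (λ i → f (suc i))

minOn : ∀ {n} → (Fin n → Bool) → (Fin n → ℕ) → Maybe ℕ
minOn {zero}  P f = nothing
minOn {suc n} P f with minOn (λ i → P (suc i)) (λ i → f (suc i))
... | r = if P zero then just (combine r) else r
  where
  combine : Maybe ℕ → ℕ
  combine nothing  = f zero
  combine (just x) = f zero ⊓ x

module _ {n : ℕ} (D : Digraph n) where
  outdeg : Fin n → ℕ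
  outdeg v = count (λ u → arc D v u)

  indeg : Fin n → ℕ
  indeg v = count (λ u → arc D u v)

  adjG : Fin n → Fin n → Bool
  adjG u v = arc D u v ∨ arc D v u

  degG : Fin n → ℕ
  degG v = count (adjG v)

  inClosedOut : Fin n → Fin n → Bool
  inClosedOut v u = ⌊ u ≟ v ⌋ ∨ arc D v u

  IsPacking : (Fin n → Bool) → Set
  IsPacking B = ∀ v → count (λ u → inClosedOut v u ∧ B u) ≤ 1

  IsPackingNumber : ℕ → Set
  IsPackingNumber r =
    Σ (Fin n → Bool) (λ B → IsPacking B × count B ≡ r)
    × (∀ B → IsPacking B → count B ≤ r)

module _ {m : ℕ} (D : Digraph (suc m)) where
  Δ δ Δ⁺ Δ⁻ δ* : ℕ
  Δ  = maxF (degG D)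
  δ  = minF (degG D)
  Δ⁺ = maxF (outdeg D)
  Δ⁻ = maxF (indeg D)
  -- minimum in-degree over vertices v with deg_G(v) = δ
  -- (this set is nonempty, so the default 0 is never used)
  δ* = fromMaybe 0 (minOn (λ v → ⌊ degG D v ℕ.≟ δ ⌋) (indeg D))

  boundNum : ℤ
  boundNum = + (suc m) ℤ.+ + Δ ℤ.- + δ ℤ.+ (+ Δ⁺ ℤ.- 1ℤ) ℤ.* (+ Δ⁻ ℤ.- + δ*)

  boundDen : ℤ
  boundDen = 1ℤ ℤ.+ + Δ ℤ.+ + Δ⁻ ℤ.* (+ Δ⁺ ℤ.- 1ℤ)

star : (m : ℕ) → Digraph (suc m)
star m = record { arc = a ; noLoop = nl }
  where
  a : Fin (suc m) → Fin (suc m) → Bool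
  a zero    zero    = false
  a zero    (suc _) = true
  a (suc _) _       = false
  nl : ∀ v → a v v ≡ false
  nl zero    = Relation.Binary.PropositionalEquality.refl
  nl (suc _) = Relation.Binary.PropositionalEquality.refl

-- Choose a vertex j of minimum G-degree δ whose in-degree is δ*, and extend {j} greedily to
-- a maximal packing B.  Every vertex u is then covered by some b ∈ B: either u ∈ B, or adding u
-- breaks the packing condition at some w, so that N⁺[w] contains both u and some b ∈ B; then
-- u = b, u is a G-neighbour of b, or u is another out-neighbour of an in-neighbour of b.  Hence b
-- covers at most 1 + deg(b) + d⁻(b)(Δ⁺ − 1) ≤ 1 + Δ + Δ⁻(Δ⁺ − 1) vertices, and only
-- 1 + δ + δ*(Δ⁺ − 1) when b = j.  Summing over B gives
--   n + (1 + Δ + Δ⁻(Δ⁺ − 1)) ≤ |B| (1 + Δ + Δ⁻(Δ⁺ − 1)) + 1 + δ + δ*(Δ⁺ − 1),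
-- which rearranges to the bound since |B| ≤ ρ(D).  In the directed star N⁺[centre] is everything,
-- so ρ = 1, and the two sides agree.

module Submission where

open import Data.Bool using (Bool; true; false; not; _∧_; _∨_; if_then_else_)
open import Data.Bool.Properties using (∨-zeroʳ; ∧-distribˡ-∨)
open import Data.Fin using (Fin; zero; suc; _≟_; punchIn)
open import Data.Fin.Properties using (all?; ¬∀⟶∃¬)
open import Data.Integer as ℤ using (+_; 1ℤ; _⊖_)
import Data.Integer.Properties as ℤₚ
import Data.Integer.Tactic.RingSolver as ℤ-Ring
open import Data.List using (List; []; _∷_; allFin)
open import Data.List.Membership.Propositional using (_∈_)
open import Data.List.Membership.Propositional.Properties using (∈-allFin)
open import Data.List.Relation.Unary.Any using (here; there)
open import Data.Maybe using (just; nothing; fromMaybe)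
import Data.Nat as ℕ
open import Data.Nat using (ℕ; zero; suc; _+_; _*_; _∸_; _≤_; z≤n; s≤s; _≤?_)
open import Data.Nat.Properties
  using (≤-refl; ≤-reflexive; ≤-trans; ≤-antisym; ≰⇒>; n≤0⇒n≡0; +-comm; +-mono-≤; +-monoˡ-≤;
         +-monoʳ-≤; *-monoˡ-≤; *-identityˡ; ∸-monoˡ-≤; m≤m+n; m+n∸m≡n; m≤m⊔n; m≤n⊔m; ⊔-lub;
         m⊓n≤m; m⊓n≤n; ⊓-glb; ⊓-sel; +-0-commutativeMonoid; module ≤-Reasoning)
import Data.Nat.Tactic.RingSolver as ℕ-Ring
open import Data.Product using (∃; _×_; _,_; proj₁; proj₂)
open import Data.Sum using (_⊎_; inj₁; inj₂)
open import Function using (_∘_)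
open import Relation.Binary.PropositionalEquality
  using (_≡_; refl; sym; trans; cong; cong₂; subst; module ≡-Reasoning)
open import Relation.Nullary using (¬_; Dec; yes; no; contradiction)
open import Relation.Nullary.Decidable using (⌊_⌋)

open import Defs

open import Algebra.Properties.CommutativeMonoid.Sum +-0-commutativeMonoid
  using (sum; sum-syntax; sum-cong-≗; sum-remove; ∑-comm; ∑-distrib-+)

∨-introˡ : ∀ {a} b → a ≡ true → a ∨ b ≡ true
∨-introˡ _ refl = refl

∨-introʳ : ∀ a {b} → b ≡ true → a ∨ b ≡ true
∨-introʳ a refl = ∨-zeroʳ a

∨-elim : ∀ a {b} → a ∨ b ≡ true → a ≡ true ⊎ b ≡ true
∨-elim true  _   = inj₁ refl
∨-elim false b≡t = inj₂ b≡t

∧-intro : ∀ {a b} → a ≡ true → b ≡ true → a ∧ b ≡ true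
∧-intro refl refl = refl

∧-elim : ∀ a {b} → a ∧ b ≡ true → a ≡ true × b ≡ true
∧-elim true b≡t = refl , b≡t

toWitnessᵇ : ∀ {a} {A : Set a} (a? : Dec A) → ⌊ a? ⌋ ≡ true → A
toWitnessᵇ (yes a) _  = a
toWitnessᵇ (no _)  ()

fromWitnessᵇ : ∀ {a} {A : Set a} (a? : Dec A) → A → ⌊ a? ⌋ ≡ true
fromWitnessᵇ (yes _) _ = refl
fromWitnessᵇ (no ¬a) a = contradiction a ¬a

_⊆_ : ∀ {n} → (Fin n → Bool) → (Fin n → Bool) → Set
A ⊆ B = ∀ x → A x ≡ true → B x ≡ true

singleton : ∀ {n} → Fin n → Fin n → Bool
singleton v u = ⌊ u ≟ v ⌋

insert : ∀ {n} → Fin n → (Fin n → Bool) → Fin n → Bool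
insert v B u = singleton v u ∨ B u

singleton-refl : ∀ {n} (v : Fin n) → singleton v v ≡ true
singleton-refl v = fromWitnessᵇ (v ≟ v) refl

singleton-≡ : ∀ {n} (v u : Fin n) → singleton v u ≡ true → u ≡ v
singleton-≡ v u = toWitnessᵇ (u ≟ v)

-- Sums and counting

indicator : Bool → ℕ
indicator b = if b then 1 else 0

∑-mono-≤ : ∀ {n} {f g : Fin n → ℕ} → (∀ i → f i ≤ g i) → sum f ≤ sum g
∑-mono-≤ {zero}  _   = z≤n
∑-mono-≤ {suc n} f≤g = +-mono-≤ (f≤g zero) (∑-mono-≤ (f≤g ∘ suc))

∑-mono-≤-except : ∀ {n} {f g : Fin (suc n) → ℕ} → (∀ i → f i ≤ g i) →
                  ∀ j → sum f + g j ≤ sum g + f j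
∑-mono-≤-except {f = f} {g} f≤g j = begin
  sum f + g j                     ≡⟨ cong (_+ g j) (sum-remove {i = j} f) ⟩
  f j + sum (f ∘ punchIn j) + g j ≤⟨ +-monoˡ-≤ (g j) (+-monoʳ-≤ (f j) (∑-mono-≤ (f≤g ∘ punchIn j))) ⟩
  f j + sum (g ∘ punchIn j) + g j ≡⟨ swap-ends (f j) (sum (g ∘ punchIn j)) (g j) ⟩
  g j + sum (g ∘ punchIn j) + f j ≡⟨ cong (_+ f j) (sum-remove {i = j} g) ⟨
  sum g + f j                     ∎
  where
  open ≤-Reasoning
  swap-ends : ∀ a b c → a + b + c ≡ c + b + a
  swap-ends = ℕ-Ring.solve-∀

∑-if : ∀ {n} (P : Fin n → Bool) c → ∑[ i < n ] (if P i then c else 0) ≡ count P * c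
∑-if {zero}  P c = refl
∑-if {suc n} P c with P zero
... | true  = cong (_+_ c) (∑-if (P ∘ suc) c)
... | false = ∑-if (P ∘ suc) c

count≡∑ : ∀ {n} (P : Fin n → Bool) → count P ≡ ∑[ i < n ] indicator (P i)
count≡∑ {zero}  P = refl
count≡∑ {suc n} P = cong (_+_ (indicator (P zero))) (count≡∑ (P ∘ suc))

count-cong : ∀ {n} {P Q : Fin n → Bool} → (∀ i → P i ≡ Q i) → count P ≡ count Q
count-cong {zero}  _   = refl
count-cong {suc n} P≗Q = cong₂ _+_ (cong indicator (P≗Q zero)) (count-cong (P≗Q ∘ suc))

count-mono : ∀ {n} {P Q : Fin n → Bool} → P ⊆ Q → count P ≤ count Q
count-mono {zero}          _   = z≤n
count-mono {suc n} {P} {Q} P⊆Q =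
  +-mono-≤ (indicator-mono (P zero) (Q zero) (P⊆Q zero)) (count-mono (P⊆Q ∘ suc))
  where
  indicator-mono : ∀ a b → (a ≡ true → b ≡ true) → indicator a ≤ indicator b
  indicator-mono false _ _   = z≤n
  indicator-mono true  _ a⇒b rewrite a⇒b refl = ≤-refl

count-∨ : ∀ {n} (P Q : Fin n → Bool) → count (λ i → P i ∨ Q i) ≤ count P + count Q
count-∨ {n} P Q = begin
  count (λ i → P i ∨ Q i)
    ≡⟨ count≡∑ (λ i → P i ∨ Q i) ⟩
  ∑[ i < n ] indicator (P i ∨ Q i)
    ≤⟨ ∑-mono-≤ (λ i → indicator-∨ (P i) (Q i)) ⟩
  ∑[ i < n ] (indicator (P i) + indicator (Q i))
    ≡⟨ ∑-distrib-+ (indicator ∘ P) (indicator ∘ Q) ⟩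
  ∑[ i < n ] indicator (P i) + ∑[ i < n ] indicator (Q i)
    ≡⟨ cong₂ _+_ (count≡∑ P) (count≡∑ Q) ⟨
  count P + count Q
    ∎
  where
  open ≤-Reasoning
  indicator-∨ : ∀ a b → indicator (a ∨ b) ≤ indicator a + indicator b
  indicator-∨ false _ = ≤-refl
  indicator-∨ true  _ = s≤s z≤n

count-split : ∀ {n} (P Q : Fin n → Bool) →
              count P ≡ count (λ i → P i ∧ Q i) + count (λ i → P i ∧ not (Q i))
count-split {n} P Q = begin
  count P
    ≡⟨ count≡∑ P ⟩
  ∑[ i < n ] indicator (P i)
    ≡⟨ sum-cong-≗ (λ i → indicator-split (P i) (Q i)) ⟩
  ∑[ i < n ] (indicator (P i ∧ Q i) + indicator (P i ∧ not (Q i)))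
    ≡⟨ ∑-distrib-+ (λ i → indicator (P i ∧ Q i)) (λ i → indicator (P i ∧ not (Q i))) ⟩
  ∑[ i < n ] indicator (P i ∧ Q i) + ∑[ i < n ] indicator (P i ∧ not (Q i))
    ≡⟨ cong₂ _+_ (count≡∑ (λ i → P i ∧ Q i)) (count≡∑ (λ i → P i ∧ not (Q i))) ⟨
  count (λ i → P i ∧ Q i) + count (λ i → P i ∧ not (Q i))
    ∎
  where
  open ≡-Reasoning
  indicator-split : ∀ a b → indicator a ≡ indicator (a ∧ b) + indicator (a ∧ not b)
  indicator-split false _     = refl
  indicator-split true  false = refl
  indicator-split true  true  = refl

count-false : ∀ n → count {n} (λ _ → false) ≡ 0
count-false zero    = refl
count-false (suc n) = count-false n

count-true : ∀ n → count {n} (λ _ → true) ≡ n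
count-true zero    = refl
count-true (suc n) = cong suc (count-true n)

count-singleton : ∀ {n} (v : Fin n) → count (singleton v) ≡ 1
count-singleton {suc n} zero    = cong suc (count-false n)
count-singleton {suc n} (suc v) = trans (count-cong (λ i → ≟-suc i v)) (count-singleton v)
  where
  ≟-suc : ∀ {n} (i v : Fin n) → ⌊ suc i ≟ suc v ⌋ ≡ ⌊ i ≟ v ⌋
  ≟-suc i v with i ≟ v
  ... | yes _ = refl
  ... | no  _ = refl

∃⇒count>0 : ∀ {n} {P : Fin n → Bool} {i} → P i ≡ true → 1 ≤ count P
∃⇒count>0 {P = P} {i} Pi = begin
  1                   ≡⟨ count-singleton i ⟨
  count (singleton i) ≤⟨ count-mono ⁅i⁆⊆P ⟩
  count P             ∎
  where
  open ≤-Reasoning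
  ⁅i⁆⊆P : singleton i ⊆ P
  ⁅i⁆⊆P x x∈⁅i⁆ = subst (λ y → P y ≡ true) (sym (singleton-≡ i x x∈⁅i⁆)) Pi

count>0⇒∃ : ∀ {n} {P : Fin n → Bool} → 1 ≤ count P → ∃ λ i → P i ≡ true
count>0⇒∃ {suc n} {P} 1≤count with P zero in P₀
... | true  = zero , P₀
... | false = let i , Pi = count>0⇒∃ 1≤count in suc i , Pi

both-positive : ∀ {a b} → a ≤ 1 → b ≤ 1 → 2 ≤ a + b → 1 ≤ a × 1 ≤ b
both-positive (s≤s z≤n) (s≤s z≤n) _        = s≤s z≤n , s≤s z≤n
both-positive z≤n       (s≤s z≤n) (s≤s ())
both-positive (s≤s z≤n) z≤n       (s≤s ())
both-positive z≤n       z≤n       ()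

any : ∀ {n} → (Fin n → Bool) → Bool
any {zero}  P = false
any {suc n} P = P zero ∨ any (P ∘ suc)

any-intro : ∀ {n} {P : Fin n → Bool} i → P i ≡ true → any P ≡ true
any-intro         zero    Pi = ∨-introˡ _ Pi
any-intro {P = P} (suc i) Pi = ∨-introʳ (P zero) (any-intro i Pi)

count-any≤∑count : ∀ {k n} (R : Fin k → Fin n → Bool) →
                   count (λ u → any (λ b → R b u)) ≤ ∑[ b < k ] count (R b)
count-any≤∑count {k} {n} R = begin
  count (λ u → any (λ b → R b u))
    ≡⟨ count≡∑ (λ u → any (λ b → R b u)) ⟩
  ∑[ u < n ] indicator (any (λ b → R b u))
    ≤⟨ ∑-mono-≤ (λ u → indicator-any≤count (λ b → R b u)) ⟩
  ∑[ u < n ] count (λ b → R b u)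
    ≡⟨ sum-cong-≗ (λ u → count≡∑ (λ b → R b u)) ⟩
  ∑[ u < n ] ∑[ b < k ] indicator (R b u)
    ≡⟨ ∑-comm (λ u b → indicator (R b u)) ⟩
  ∑[ b < k ] ∑[ u < n ] indicator (R b u)
    ≡⟨ sum-cong-≗ (λ b → count≡∑ (R b)) ⟨
  ∑[ b < k ] count (R b)
    ∎
  where
  open ≤-Reasoning
  indicator-any≤count : ∀ {k} (P : Fin k → Bool) → indicator (any P) ≤ count P
  indicator-any≤count {zero}  P = z≤n
  indicator-any≤count {suc k} P with P zero
  ... | true  = s≤s z≤n
  ... | false = indicator-any≤count (P ∘ suc)

count-covered : ∀ {k n} (R : Fin k → Fin n → Bool) → (∀ u → ∃ λ b → R b u ≡ true) →
                n ≤ ∑[ b < k ] count (R b)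
count-covered {k} {n} R covered = begin
  n                               ≡⟨ count-true n ⟨
  count {n} (λ _ → true)          ≤⟨ count-mono all-covered ⟩
  count (λ u → any (λ b → R b u)) ≤⟨ count-any≤∑count R ⟩
  ∑[ b < k ] count (R b)          ∎
  where
  open ≤-Reasoning
  all-covered : (λ _ → true) ⊆ (λ u → any (λ b → R b u))
  all-covered u _ = let b , Rbu = covered u in any-intro b Rbu

-- Extremal values

maxF-ub : ∀ {m} (f : Fin (suc m) → ℕ) i → f i ≤ maxF f
maxF-ub {zero}  f zero    = ≤-refl
maxF-ub {suc m} f zero    = m≤m⊔n (f zero) _
maxF-ub {suc m} f (suc i) = ≤-trans (maxF-ub (f ∘ suc) i) (m≤n⊔m (f zero) _)

maxF-lub : ∀ {m} {f : Fin (suc m) → ℕ} {c} → (∀ i → f i ≤ c) → maxF f ≤ c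
maxF-lub {zero}  f≤c = f≤c zero
maxF-lub {suc m} f≤c = ⊔-lub (f≤c zero) (maxF-lub (f≤c ∘ suc))

maxF-≡ : ∀ {m} (f : Fin (suc m) → ℕ) {c} j → f j ≡ c → (∀ i → f i ≤ c) → maxF f ≡ c
maxF-≡ f j fj≡c f≤c = ≤-antisym (maxF-lub f≤c) (subst (_≤ maxF f) fj≡c (maxF-ub f j))

minF-lb : ∀ {m} (f : Fin (suc m) → ℕ) i → minF f ≤ f i
minF-lb {zero}  f zero    = ≤-refl
minF-lb {suc m} f zero    = m⊓n≤m (f zero) _
minF-lb {suc m} f (suc i) = ≤-trans (m⊓n≤n (f zero) _) (minF-lb (f ∘ suc) i)

minF-glb : ∀ {m} {f : Fin (suc m) → ℕ} {c} → (∀ i → c ≤ f i) → c ≤ minF f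
minF-glb {zero}  c≤f = c≤f zero
minF-glb {suc m} c≤f = ⊓-glb (c≤f zero) (minF-glb (c≤f ∘ suc))

minF-≡ : ∀ {m} (f : Fin (suc m) → ℕ) {c} j → f j ≡ c → (∀ i → c ≤ f i) → minF f ≡ c
minF-≡ f j fj≡c c≤f = ≤-antisym (subst (minF f ≤_) fj≡c (minF-lb f j)) (minF-glb c≤f)

minF-attained : ∀ {m} (f : Fin (suc m) → ℕ) → ∃ λ i → minF f ≡ f i
minF-attained {zero}  f = zero , refl
minF-attained {suc m} f with ⊓-sel (f zero) (minF (f ∘ suc))
... | inj₁ min≡f₀   = zero , min≡f₀
... | inj₂ min≡rest = let i , rest≡fi = minF-attained (f ∘ suc) in suc i , trans min≡rest rest≡fi

minOn-spec : ∀ {n} (P : Fin n → Bool) (f : Fin n → ℕ) →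
             (∀ i → P i ≡ false) × minOn P f ≡ nothing
             ⊎ ∃ λ j → P j ≡ true × minOn P f ≡ just (f j)
minOn-spec {zero}  P f = inj₁ ((λ ()) , refl)
minOn-spec {suc n} P f
  with minOn (λ i → P (suc i)) (λ i → f (suc i)) | minOn-spec (λ i → P (suc i)) (λ i → f (suc i))
     | P zero in P₀
... | .nothing            | inj₁ (none , refl)   | false = inj₁ (none′ , refl)
  where
  none′ : ∀ i → P i ≡ false
  none′ zero    = P₀
  none′ (suc i) = none i
... | .nothing            | inj₁ (none , refl)   | true  = inj₂ (zero , P₀ , refl)
... | .(just (f (suc j))) | inj₂ (j , Pj , refl) | false = inj₂ (suc j , Pj , refl)
... | .(just (f (suc j))) | inj₂ (j , Pj , refl) | true with ⊓-sel (f zero) (f (suc j))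
...   | inj₁ min≡f₀ = inj₂ (zero , P₀ , cong just min≡f₀)
...   | inj₂ min≡fj = inj₂ (suc j , Pj , cong just min≡fj)

minOn-attained : ∀ {n} (P : Fin n → Bool) (f : Fin n → ℕ) {i} → P i ≡ true →
                 ∃ λ j → P j ≡ true × minOn P f ≡ just (f j)
minOn-attained P f {i} Pi with minOn-spec P f
... | inj₁ (none , _) = contradiction (trans (sym Pi) (none i)) λ ()
... | inj₂ attained   = attained

module MaximalExtension {n ℓ} (P : (Fin n → Bool) → Set ℓ) (P? : ∀ B → Dec (P B))
                        (P-⊆ : ∀ {A B} → A ⊆ B → P B → P A) where

  Maximal : (Fin n → Bool) → Set ℓ
  Maximal B = ∀ u → B u ≡ true ⊎ ¬ P (insert u B)

  private
    step : Fin n → (Fin n → Bool) → Fin n → Bool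
    step u B with P? (insert u B)
    ... | yes _ = insert u B
    ... | no  _ = B

    grow : List (Fin n) → (Fin n → Bool) → Fin n → Bool
    grow []       B = B
    grow (u ∷ us) B = grow us (step u B)

    ⊆-insert : ∀ (u : Fin n) B → B ⊆ insert u B
    ⊆-insert u B x = ∨-introʳ (singleton u x)

    insert-mono : ∀ (u : Fin n) {A B} → A ⊆ B → insert u A ⊆ insert u B
    insert-mono u A⊆B x x∈uA with ∨-elim (singleton u x) x∈uA
    ... | inj₁ x∈⁅u⁆ = ∨-introˡ _ x∈⁅u⁆
    ... | inj₂ x∈A   = ∨-introʳ (singleton u x) (A⊆B x x∈A)

    ⊆-step : ∀ u B → B ⊆ step u B
    ⊆-step u B with P? (insert u B)
    ... | yes _ = ⊆-insert u B
    ... | no  _ = λ _ x∈B → x∈B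

    step-pres : ∀ u {B} → P B → P (step u B)
    step-pres u {B} PB with P? (insert u B)
    ... | yes P[uB] = P[uB]
    ... | no  _     = PB

    ⊆-grow : ∀ us B → B ⊆ grow us B
    ⊆-grow []       B _ x∈B = x∈B
    ⊆-grow (u ∷ us) B x     = ⊆-grow us (step u B) x ∘ ⊆-step u B x

    grow-pres : ∀ us {B} → P B → P (grow us B)
    grow-pres []       PB = PB
    grow-pres (u ∷ us) PB = grow-pres us (step-pres u PB)

    -- A vertex that could not be added at its turn cannot be added later: P is downward closed.
    grow-maximal : ∀ us B {u} → u ∈ us → grow us B u ≡ true ⊎ ¬ P (insert u (grow us B))
    grow-maximal (u ∷ us) B (here refl) with P? (insert u B)
    ... | yes _      = inj₁ (⊆-grow us (insert u B) u (∨-introˡ (B u) (singleton-refl u)))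
    ... | no  ¬P[uB] = inj₂ (¬P[uB] ∘ P-⊆ (insert-mono u (⊆-grow us B)))
    grow-maximal (u ∷ us) B (there v∈us) = grow-maximal us (step u B) v∈us

  extend-to-maximal : ∀ {B} → P B → ∃ λ M → B ⊆ M × P M × Maximal M
  extend-to-maximal {B} PB =
    grow (allFin n) B , ⊆-grow (allFin n) B , grow-pres (allFin n) PB ,
    λ u → grow-maximal (allFin n) B (∈-allFin u)

-- Packings and the vertices they cover

module _ {n} (D : Digraph n) where

  isPacking? : ∀ B → Dec (IsPacking D B)
  isPacking? B = all? (λ v → count (λ u → inClosedOut D v u ∧ B u) ≤? 1)

  packing-⊆ : ∀ {A B} → A ⊆ B → IsPacking D B → IsPacking D A
  packing-⊆ {A} {B} A⊆B B-packing v = ≤-trans (count-mono N[v]∩A⊆N[v]∩B) (B-packing v)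
    where
    N[v]∩A⊆N[v]∩B : (λ u → inClosedOut D v u ∧ A u) ⊆ (λ u → inClosedOut D v u ∧ B u)
    N[v]∩A⊆N[v]∩B u u∈N[v]∩A =
      let u∈N[v] , u∈A = ∧-elim (inClosedOut D v u) u∈N[v]∩A in ∧-intro u∈N[v] (A⊆B u u∈A)

  singleton-packing : ∀ v → IsPacking D (singleton v)
  singleton-packing v w = begin
    count (λ u → inClosedOut D w u ∧ singleton v u)
      ≤⟨ count-mono (λ u → proj₂ ∘ ∧-elim (inClosedOut D w u)) ⟩
    count (singleton v)
      ≡⟨ count-singleton v ⟩
    1 ∎
    where open ≤-Reasoning

  open MaximalExtension (IsPacking D) isPacking? packing-⊆ public using (Maximal; extend-to-maximal)

  commonInNeighbour : Fin n → Fin n → Fin n → Bool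
  commonInNeighbour b w u = arc D w b ∧ (arc D w u ∧ not (singleton b u))

  covers : Fin n → Fin n → Bool
  covers b u = singleton b u ∨ (adjG D b u ∨ any (λ w → commonInNeighbour b w u))

  closedOut-cases : ∀ {w x} → inClosedOut D w x ≡ true → x ≡ w ⊎ arc D w x ≡ true
  closedOut-cases {w} {x} x∈N[w] with ∨-elim (singleton w x) x∈N[w]
  ... | inj₁ x∈⁅w⁆ = inj₁ (singleton-≡ w x x∈⁅w⁆)
  ... | inj₂ w→x   = inj₂ w→x

  shared-closedOut⇒covers : ∀ {w b u} → inClosedOut D w b ≡ true → inClosedOut D w u ≡ true →
                            covers b u ≡ true
  shared-closedOut⇒covers {w} {b} {u} b∈N[w] u∈N[w] with u ≟ b
  ... | yes _   = refl
  ... | no  u≢b with closedOut-cases b∈N[w] | closedOut-cases u∈N[w]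
  ...   | inj₁ refl | inj₁ refl = contradiction refl u≢b
  ...   | inj₁ refl | inj₂ b→u  = ∨-introˡ _ (∨-introˡ _ b→u)
  ...   | inj₂ u→b  | inj₁ refl = ∨-introˡ _ (∨-introʳ (arc D b u) u→b)
  ...   | inj₂ w→b  | inj₂ w→u  =
    ∨-introʳ (adjG D b u) (any-intro w (∧-intro w→b (∧-intro w→u refl)))

  count-commonInNeighbour : ∀ {k} → (∀ w → outdeg D w ≤ k) →
                            ∀ b w → count (commonInNeighbour b w) ≤ (if arc D w b then k ∸ 1 else 0)
  count-commonInNeighbour {k} outdeg≤k b w with arc D w b in w→b
  ... | false = ≤-reflexive (count-false n)
  ... | true  = ∸-monoˡ-≤ 1 (begin
    suc (count (λ u → arc D w u ∧ not (singleton b u)))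
      ≤⟨ +-monoˡ-≤ _ (∃⇒count>0 {i = b} (∧-intro w→b (singleton-refl b))) ⟩
    count (λ u → arc D w u ∧ singleton b u) + count (λ u → arc D w u ∧ not (singleton b u))
      ≡⟨ count-split (arc D w) (singleton b) ⟨
    outdeg D w
      ≤⟨ outdeg≤k w ⟩
    k ∎)
    where open ≤-Reasoning

  count-covers : ∀ {k} → (∀ w → outdeg D w ≤ k) →
                 ∀ b → count (covers b) ≤ suc (degG D b + indeg D b * (k ∸ 1))
  count-covers {k} outdeg≤k b = begin
    count (covers b)
      ≤⟨ count-∨ (singleton b) _ ⟩
    count (singleton b) + count (λ u → adjG D b u ∨ any (λ w → commonInNeighbour b w u))
      ≤⟨ +-mono-≤ (≤-reflexive (count-singleton b)) (count-∨ (adjG D b) _) ⟩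
    1 + (degG D b + count (λ u → any (λ w → commonInNeighbour b w u)))
      ≤⟨ +-monoʳ-≤ 1 (+-monoʳ-≤ (degG D b) (count-any≤∑count (commonInNeighbour b))) ⟩
    1 + (degG D b + ∑[ w < n ] count (commonInNeighbour b w))
      ≤⟨ +-monoʳ-≤ 1 (+-monoʳ-≤ (degG D b) (∑-mono-≤ (count-commonInNeighbour outdeg≤k b))) ⟩
    1 + (degG D b + ∑[ w < n ] (if arc D w b then k ∸ 1 else 0))
      ≡⟨ cong (λ x → 1 + (degG D b + x)) (∑-if (λ w → arc D w b) (k ∸ 1)) ⟩
    suc (degG D b + indeg D b * (k ∸ 1)) ∎
    where open ≤-Reasoning

  overfull-closedOut : ∀ {B} w u → IsPacking D B →
                       ¬ count (λ x → inClosedOut D w x ∧ insert u B x) ≤ 1 →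
                       inClosedOut D w u ≡ true × ∃ λ b → inClosedOut D w b ≡ true × B b ≡ true
  overfull-closedOut {B} w u B-packing overfull =
    u∈N[w] , proj₁ B∩N[w]≠∅ , ∧-elim (inClosedOut D w _) (proj₂ B∩N[w]≠∅)
    where
    N[w]∩⁅u⁆ N[w]∩B : Fin n → Bool
    N[w]∩⁅u⁆ x = inClosedOut D w x ∧ singleton u x
    N[w]∩B   x = inClosedOut D w x ∧ B x
    2≤sum : 2 ≤ count N[w]∩⁅u⁆ + count N[w]∩B
    2≤sum = begin
      2
        ≤⟨ ≰⇒> overfull ⟩
      count (λ x → inClosedOut D w x ∧ insert u B x)
        ≡⟨ count-cong (λ x → ∧-distribˡ-∨ (inClosedOut D w x) (singleton u x) (B x)) ⟩
      count (λ x → N[w]∩⁅u⁆ x ∨ N[w]∩B x)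
        ≤⟨ count-∨ N[w]∩⁅u⁆ N[w]∩B ⟩
      count N[w]∩⁅u⁆ + count N[w]∩B ∎
      where open ≤-Reasoning
    nonempty : 1 ≤ count N[w]∩⁅u⁆ × 1 ≤ count N[w]∩B
    nonempty = both-positive
      (≤-trans (count-mono (λ x → proj₂ ∘ ∧-elim (inClosedOut D w x)))
               (≤-reflexive (count-singleton u)))
      (B-packing w) 2≤sum
    u∈N[w] : inClosedOut D w u ≡ true
    u∈N[w] with count>0⇒∃ {P = N[w]∩⁅u⁆} (proj₁ nonempty)
    ... | x , x∈N[w]∩⁅u⁆ =
      let x∈N[w] , x∈⁅u⁆ = ∧-elim (inClosedOut D w x) x∈N[w]∩⁅u⁆
      in subst (λ y → inClosedOut D w y ≡ true) (singleton-≡ u x x∈⁅u⁆) x∈N[w]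
    B∩N[w]≠∅ : ∃ λ b → N[w]∩B b ≡ true
    B∩N[w]≠∅ = count>0⇒∃ (proj₂ nonempty)

  maximal-packing-covers : ∀ {B} → IsPacking D B → Maximal B →
                           ∀ u → ∃ λ b → B b ≡ true × covers b u ≡ true
  maximal-packing-covers {B} B-packing B-maximal u with B-maximal u
  ... | inj₁ u∈B = u , u∈B , ∨-introˡ _ (singleton-refl u)
  ... | inj₂ ¬packing
    with ¬∀⟶∃¬ n _ (λ w → count (λ x → inClosedOut D w x ∧ insert u B x) ≤? 1) ¬packing
  ...   | w , overfull with overfull-closedOut w u B-packing overfull
  ...     | u∈N[w] , b , b∈N[w] , b∈B = b , b∈B , shared-closedOut⇒covers b∈N[w] u∈N[w]

packingNumber≥1 : ∀ {m} (D : Digraph (suc m)) {r} → IsPackingNumber D r → 1 ≤ r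
packingNumber≥1 {m} D {r} (_ , maximum) =
  subst (_≤ r) (count-singleton {suc m} zero) (maximum (singleton zero) (singleton-packing D zero))

m+n⊖m≡n : ∀ m n → (m + n) ⊖ m ≡ + n
m+n⊖m≡n m n = trans (ℤₚ.⊖-≥ (m≤m+n m n)) (cong +_ (m+n∸m≡n m n))

m≤n+o⇒m⊖o≤n : ∀ {m n o} → m ≤ n + o → m ⊖ o ℤ.≤ + n
m≤n+o⇒m⊖o≤n {m} {n} {o} m≤n+o = begin
  m ⊖ o       ≤⟨ ℤₚ.⊖-monoˡ-≤ o m≤n+o ⟩
  (n + o) ⊖ o ≡⟨ cong (_⊖ o) (+-comm n o) ⟩
  (o + n) ⊖ o ≡⟨ m+n⊖m≡n o n ⟩
  + n         ∎
  where open ℤₚ.≤-Reasoning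

-- For q = 0 the integer factor is −1 while q ∸ 1 truncates to 0, hence the hypothesis.
pos-*-∸1 : ∀ q x → (q ≡ 0 → x ≡ 0) → + x ℤ.* (+ q ℤ.- 1ℤ) ≡ + (x * (q ∸ 1))
pos-*-∸1 zero    x q≡0⇒x≡0 rewrite q≡0⇒x≡0 refl = refl
pos-*-∸1 (suc q) x _        = sym (ℤₚ.pos-* x q)

module _ {m} (D : Digraph (suc m)) where

  Δ⁺₋₁ : ℕ
  Δ⁺₋₁ = Δ⁺ D ∸ 1

  coverBound : Fin (suc m) → ℕ
  coverBound b = suc (degG D b + indeg D b * Δ⁺₋₁)

  maxCoverBound : ℕ
  maxCoverBound = suc (Δ D + Δ⁻ D * Δ⁺₋₁)

  coverBound≤max : ∀ b → coverBound b ≤ maxCoverBound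
  coverBound≤max b = s≤s (+-mono-≤ (maxF-ub (degG D) b) (*-monoˡ-≤ Δ⁺₋₁ (maxF-ub (indeg D) b)))

  δ*-attained : ∃ λ j → degG D j ≡ δ D × indeg D j ≡ δ* D
  δ*-attained with minF-attained (degG D)
  ... | i , δ≡deg-i
    with minOn-attained (λ v → ⌊ degG D v ℕ.≟ δ D ⌋) (indeg D)
                        (fromWitnessᵇ (degG D i ℕ.≟ δ D) (sym δ≡deg-i))
  ... | j , deg-j≟δ , min≡in-j =
    j , toWitnessᵇ (degG D j ℕ.≟ δ D) deg-j≟δ , sym (cong (fromMaybe 0) min≡in-j)

  δ*≤Δ⁻ : δ* D ≤ Δ⁻ D
  δ*≤Δ⁻ = let j , _ , in-j≡δ* = δ*-attained in subst (_≤ Δ⁻ D) in-j≡δ* (maxF-ub (indeg D) j)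

  Δ⁺≡0⇒Δ⁻≡0 : Δ⁺ D ≡ 0 → Δ⁻ D ≡ 0
  Δ⁺≡0⇒Δ⁻≡0 Δ⁺≡0 = n≤0⇒n≡0 (maxF-lub λ v → begin
    indeg D v                   ≤⟨ count-mono (no-arc v) ⟩
    count {suc m} (λ _ → false) ≡⟨ count-false (suc m) ⟩
    0                           ∎)
    where
    open ≤-Reasoning
    no-arc : ∀ v u → arc D u v ≡ true → false ≡ true
    no-arc v u u→v = contradiction (subst (1 ≤_) Δ⁺≡0 1≤Δ⁺) λ ()
      where
      1≤Δ⁺ : 1 ≤ Δ⁺ D
      1≤Δ⁺ = ≤-trans (∃⇒count>0 {P = arc D u} u→v) (maxF-ub (outdeg D) u)

  Δ⁺≡0⇒δ*≡0 : Δ⁺ D ≡ 0 → δ* D ≡ 0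
  Δ⁺≡0⇒δ*≡0 Δ⁺≡0 = n≤0⇒n≡0 (subst (δ* D ≤_) (Δ⁺≡0⇒Δ⁻≡0 Δ⁺≡0) δ*≤Δ⁻)

  covering-inequality : ∀ {B j} → IsPacking D B → Maximal D B → B j ≡ true →
                        suc m + maxCoverBound ≤ count B * maxCoverBound + coverBound j
  covering-inequality {B} {j} B-packing B-maximal j∈B = begin
    suc m + maxCoverBound ≤⟨ +-monoˡ-≤ maxCoverBound covered ⟩
    sum f + maxCoverBound ≡⟨ cong (λ x → sum f + (if x then maxCoverBound else 0)) j∈B ⟨
    sum f + g j           ≤⟨ ∑-mono-≤-except f≤g j ⟩
    sum g + f j           ≡⟨ cong₂ _+_ (∑-if B maxCoverBound)
                                        (cong (λ x → if x then coverBound j else 0) j∈B) ⟩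
    count B * maxCoverBound + coverBound j ∎
    where
    open ≤-Reasoning
    f g : Fin (suc m) → ℕ
    f b = if B b then coverBound b else 0
    g b = if B b then maxCoverBound else 0
    f≤g : ∀ b → f b ≤ g b
    f≤g b with B b
    ... | true  = coverBound≤max b
    ... | false = z≤n
    count≤f : ∀ b → count (λ u → B b ∧ covers D b u) ≤ f b
    count≤f b with B b
    ... | true  = count-covers D (maxF-ub (outdeg D)) b
    ... | false = ≤-reflexive (count-false (suc m))
    B-covers : ∀ u → ∃ λ b → (B b ∧ covers D b u) ≡ true
    B-covers u = let b , b∈B , b-covers-u = maximal-packing-covers D B-packing B-maximal u
                 in b , ∧-intro b∈B b-covers-u
    covered : suc m ≤ sum f
    covered = begin
      suc m                                           ≤⟨ count-covered _ B-covers ⟩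
      ∑[ b < suc m ] count (λ u → B b ∧ covers D b u) ≤⟨ ∑-mono-≤ count≤f ⟩
      sum f                                           ∎

  packingNumber-bound : ∀ {r} → IsPackingNumber D r →
                        suc m + maxCoverBound ≤ r * maxCoverBound + suc (δ D + δ* D * Δ⁺₋₁)
  packingNumber-bound {r} (_ , maximum) with δ*-attained
  ... | j , deg-j≡δ , in-j≡δ* with extend-to-maximal D {singleton j} (singleton-packing D j)
  ... | B , ⁅j⁆⊆B , B-packing , B-maximal = begin
    suc m + maxCoverBound
      ≤⟨ covering-inequality B-packing B-maximal (⁅j⁆⊆B j (singleton-refl j)) ⟩
    count B * maxCoverBound + coverBound j
      ≤⟨ +-monoˡ-≤ (coverBound j) (*-monoˡ-≤ maxCoverBound (maximum B B-packing)) ⟩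
    r * maxCoverBound + coverBound j
      ≡⟨ cong (λ d → r * maxCoverBound + suc (d + indeg D j * Δ⁺₋₁)) deg-j≡δ ⟩
    r * maxCoverBound + suc (δ D + indeg D j * Δ⁺₋₁)
      ≡⟨ cong (λ i → r * maxCoverBound + suc (δ D + i * Δ⁺₋₁)) in-j≡δ* ⟩
    r * maxCoverBound + suc (δ D + δ* D * Δ⁺₋₁) ∎
    where open ≤-Reasoning

  boundDen≡ : boundDen D ≡ + maxCoverBound
  boundDen≡ = cong (ℤ._+_ (1ℤ ℤ.+ + Δ D)) (pos-*-∸1 (Δ⁺ D) (Δ⁻ D) Δ⁺≡0⇒Δ⁻≡0)

  boundNum≡ : boundNum D ≡ (suc m + maxCoverBound) ⊖ suc (δ D + δ* D * Δ⁺₋₁)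
  boundNum≡ = begin
    boundNum D
      ≡⟨ distribute (+ suc m) (+ Δ D) (+ δ D) (+ Δ⁻ D) (+ δ* D) pred-Δ⁺ ⟩
    (+ suc m ℤ.+ + Δ D ℤ.+ + Δ⁻ D ℤ.* pred-Δ⁺) ℤ.- (+ δ D ℤ.+ + δ* D ℤ.* pred-Δ⁺)
      ≡⟨ cong₂ (λ x y → (+ suc m ℤ.+ + Δ D ℤ.+ x) ℤ.- (+ δ D ℤ.+ y))
               (pos-*-∸1 (Δ⁺ D) (Δ⁻ D) Δ⁺≡0⇒Δ⁻≡0) (pos-*-∸1 (Δ⁺ D) (δ* D) Δ⁺≡0⇒δ*≡0) ⟩
    + (suc m + Δ D + Δ⁻ D * Δ⁺₋₁) ℤ.- + (δ D + δ* D * Δ⁺₋₁)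
      ≡⟨ ℤₚ.[+m]-[+n]≡m⊖n (suc m + Δ D + Δ⁻ D * Δ⁺₋₁) (δ D + δ* D * Δ⁺₋₁) ⟩
    (suc m + Δ D + Δ⁻ D * Δ⁺₋₁) ⊖ (δ D + δ* D * Δ⁺₋₁)
      ≡⟨ ℤₚ.[1+m]⊖[1+n]≡m⊖n (suc m + Δ D + Δ⁻ D * Δ⁺₋₁) (δ D + δ* D * Δ⁺₋₁) ⟨
    suc (suc m + Δ D + Δ⁻ D * Δ⁺₋₁) ⊖ suc (δ D + δ* D * Δ⁺₋₁)
      ≡⟨ cong (_⊖ suc (δ D + δ* D * Δ⁺₋₁)) (suc-assoc (suc m) (Δ D) (Δ⁻ D * Δ⁺₋₁)) ⟩
    (suc m + maxCoverBound) ⊖ suc (δ D + δ* D * Δ⁺₋₁) ∎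
    where
    open ≡-Reasoning
    pred-Δ⁺ : ℤ.ℤ
    pred-Δ⁺ = + Δ⁺ D ℤ.- 1ℤ
    distribute : ∀ n a d x y p →
                 n ℤ.+ a ℤ.- d ℤ.+ p ℤ.* (x ℤ.- y) ≡ (n ℤ.+ a ℤ.+ x ℤ.* p) ℤ.- (d ℤ.+ y ℤ.* p)
    distribute = ℤ-Ring.solve-∀
    suc-assoc : ∀ a b c → suc (a + b + c) ≡ a + suc (b + c)
    suc-assoc = ℕ-Ring.solve-∀

packing-lower-bound : (m : ℕ) (D : Digraph (suc m)) (r : ℕ) → IsPackingNumber D r →
                      boundNum D ℤ.≤ + r ℤ.* boundDen D
packing-lower-bound m D r ρ≡r = begin
  boundNum D                                            ≡⟨ boundNum≡ D ⟩
  (suc m + maxCoverBound D) ⊖ suc (δ D + δ* D * Δ⁺₋₁ D)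
    ≤⟨ m≤n+o⇒m⊖o≤n (packingNumber-bound D ρ≡r) ⟩
  + (r * maxCoverBound D)                               ≡⟨ ℤₚ.pos-* r (maxCoverBound D) ⟩
  + r ℤ.* + maxCoverBound D                             ≡⟨ cong (ℤ._*_ (+ r)) (boundDen≡ D) ⟨
  + r ℤ.* boundDen D                                    ∎
  where open ℤₚ.≤-Reasoning

-- The directed star

star-centre-dominates : ∀ m u → inClosedOut (star m) zero u ≡ true
star-centre-dominates m zero    = refl
star-centre-dominates m (suc u) = refl

star-packingNumber : ∀ m {r} → IsPackingNumber (star m) r → r ≡ 1
star-packingNumber m {r} ρ≡r@((B , B-packing , |B|≡r) , _) =
  ≤-antisym r≤1 (packingNumber≥1 (star m) ρ≡r)
  where
  open ≤-Reasoning
  B⊆N[centre]∩B : B ⊆ (λ u → inClosedOut (star m) zero u ∧ B u)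
  B⊆N[centre]∩B u = ∧-intro (star-centre-dominates m u)
  r≤1 : r ≤ 1
  r≤1 = begin
    r                                               ≡⟨ |B|≡r ⟨
    count B                                         ≤⟨ count-mono B⊆N[centre]∩B ⟩
    count (λ u → inClosedOut (star m) zero u ∧ B u) ≤⟨ B-packing zero ⟩
    1                                               ∎

module _ (k : ℕ) where

  private
    S : Digraph (suc (suc (suc k)))
    S = star (suc (suc k))

  star-centre-degG : degG S zero ≡ suc (suc k)
  star-centre-degG = count-true (suc (suc k))

  star-centre-outdeg : outdeg S zero ≡ suc (suc k)
  star-centre-outdeg = count-true (suc (suc k))

  star-leaf-degG : ∀ i → degG S (suc i) ≡ 1
  star-leaf-degG i = cong suc (count-false (suc k))

  star-leaf-outdeg : ∀ i → outdeg S (suc i) ≡ 0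
  star-leaf-outdeg i = count-false (suc (suc k))

  star-leaf-indeg : ∀ i → indeg S (suc i) ≡ 1
  star-leaf-indeg i = cong suc (count-false (suc k))

  star-δ : δ S ≡ 1
  star-δ = minF-≡ (degG S) (suc zero) (star-leaf-degG zero) λ
    { zero    → subst (1 ≤_) (sym star-centre-degG) (s≤s z≤n)
    ; (suc i) → ≤-reflexive (sym (star-leaf-degG i)) }

  star-Δ⁺ : Δ⁺ S ≡ suc (suc k)
  star-Δ⁺ = maxF-≡ (outdeg S) zero star-centre-outdeg λ
    { zero    → ≤-reflexive star-centre-outdeg
    ; (suc i) → subst (_≤ suc (suc k)) (sym (star-leaf-outdeg i)) z≤n }

  star-δ* : δ* S ≡ 1
  star-δ* with δ*-attained S
  ... | zero  , deg≡δ , _     = contradiction (trans (sym star-centre-degG) (trans deg≡δ star-δ)) λ ()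
  ... | suc i , _     , in≡δ* = trans (sym in≡δ*) (star-leaf-indeg i)

  star-δ+δ*Δ⁺₋₁ : δ S + δ* S * Δ⁺₋₁ S ≡ suc (suc k)
  star-δ+δ*Δ⁺₋₁ = begin
    δ S + δ* S * Δ⁺₋₁ S ≡⟨ cong₂ (λ d i → d + i * Δ⁺₋₁ S) star-δ star-δ* ⟩
    1 + 1 * (Δ⁺ S ∸ 1)  ≡⟨ cong (λ q → 1 + 1 * (q ∸ 1)) star-Δ⁺ ⟩
    1 + 1 * suc k       ≡⟨ cong suc (*-identityˡ (suc k)) ⟩
    suc (suc k)         ∎
    where open ≡-Reasoning

-- Small stars are settled by evaluation: in star 1 both vertices have minimum degree, so δ* = 0.
star-attains-bound : (m r : ℕ) → IsPackingNumber (star m) r →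
                     + r ℤ.* boundDen (star m) ≡ boundNum (star m)
star-attains-bound m r ρ≡r with star-packingNumber m ρ≡r
star-attains-bound zero          _ _ | refl = refl
star-attains-bound (suc zero)    _ _ | refl = refl
star-attains-bound (suc (suc k)) _ _ | refl = begin
  + 1 ℤ.* boundDen S                                ≡⟨ ℤₚ.*-identityˡ (boundDen S) ⟩
  boundDen S                                        ≡⟨ boundDen≡ S ⟩
  + maxCoverBound S                                 ≡⟨ m+n⊖m≡n n (maxCoverBound S) ⟨
  (n + maxCoverBound S) ⊖ n                         ≡⟨ cong (λ c → (n + maxCoverBound S) ⊖ suc c) (star-δ+δ*Δ⁺₋₁ k) ⟨
  (n + maxCoverBound S) ⊖ suc (δ S + δ* S * Δ⁺₋₁ S) ≡⟨ boundNum≡ S ⟨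
  boundNum S                                        ∎
  where
  open ≡-Reasoning
  n : ℕ
  n = suc (suc (suc k))
  S : Digraph n
  S = star (suc (suc k))

theorem9 : ((m : ℕ) (D : Digraph (suc m)) (r : ℕ) → IsPackingNumber D r
               → boundNum D ℤ.≤ + r ℤ.* boundDen D)
             × ((m : ℕ) (r : ℕ) → IsPackingNumber (star m) r
               → + r ℤ.* boundDen (star m) ≡ boundNum (star m))
theorem9 = packing-lower-bound , star-attains-bound
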